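{- For any pseudo-hoop $A$, every type II state operator on $A$ is a type III state operator on $A$.
   Context: A pseudo-hoop is an algebra $(A,\odot,\rightarrow,\rightsquigarrow,1)$ of type $(2,2,2,0)$ such that for all $x,y,z\in A$: $x\odot 1=1\odot x=x$; $x\rightarrow x=x\rightsquigarrow x=1$; $(x\odot y)\rightarrow z=x\rightarrow(y\rightarrow z)$; $(x\odot y)\rightsquigarrow z=y\rightsquigarrow(x\rightsquigarrow z)$; $(x\rightarrow y)\odot x=(y\rightarrow x)\odot y=x\odot(x\rightsquigarrow y)=y\odot(y\rightsquigarrow x)$. The order is $x\le y$ iff $x\rightarrow y=1$; $(A,\le)$ is a meet-semilattice with $x\wedge y=(x\rightarrow y)\odot x$. Put $x\vee_1 y=(x\rightarrow y)\rightsquigarrow y$, $x\vee_2 y=(x\rightsquigarrow y)\rightarrow y$. For $\mu:A\to A$ and all $x,y$ consider: (IS1') $\mu(x\rightarrow y)=\mu(y\vee_1 x)\rightarrow\mu(y)$ and $\mu(x\rightsquigarrow y)=\mu(y\vee_2 x)\rightsquigarrow\mu(y)$; (IS1'') $\mu(x\rightarrow y)=\mu(x)\rightarrow\mu(x\wedge y)$ and $\mu(x\rightsquigarrow y)=\mu(x)\rightsquigarrow\mu(x\wedge y)$; (IS2) $\mu(x\odot y)=\mu(x)\odot\mu(x\rightsquigarrow x\odot y)=\mu(y\rightarrow x\odot y)\odot\mu(y)$; (IS3) $\mu(\mu(x)\odot\mu(y))=\mu(x)\odot\mu(y)$; (IS4) $\mu(\mu(x)\rightarrow\mu(y))=\mu(x)\rightarrow\mu(y)$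 and $\mu(\mu(x)\rightsquigarrow\mu(y))=\mu(x)\rightsquigarrow\mu(y)$. A type II state operator satisfies (IS1'),(IS2),(IS3),(IS4); a type III state operator satisfies (IS1''),(IS2),(IS3),(IS4). -}

module Defs where

open import Level using (Level; suc)
open import Relation.Binary.PropositionalEquality using (_≡_)
open import Data.Product using (_×_)

record PseudoHoop (a : Level) : Set (suc a) where
  infixl 7 _⊙_
  infixr 5 _⇒_ _⇝_
  field
    Carrier : Set a
    _⊙_ : Carrier → Carrier → Carrier
    _⇒_ : Carrier → Carrier → Carrier
    _⇝_ : Carrier → Carrier → Carrier
    𝟏 : Carrier
    ⊙-identityʳ : ∀ x → x ⊙ 𝟏 ≡ x
    ⊙-identityˡ : ∀ x → 𝟏 ⊙ x ≡ x
    ⇒-refl : ∀ x → x ⇒ x ≡ 𝟏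
    ⇝-refl : ∀ x → x ⇝ x ≡ 𝟏
    ⇒-curry : ∀ x y z → (x ⊙ y) ⇒ z ≡ x ⇒ (y ⇒ z)
    ⇝-curry : ∀ x y z → (x ⊙ y) ⇝ z ≡ y ⇝ (x ⇝ z)
    divisibility₁ : ∀ x y → (x ⇒ y) ⊙ x ≡ (y ⇒ x) ⊙ y
    divisibility₂ : ∀ x y → (y ⇒ x) ⊙ y ≡ x ⊙ (x ⇝ y)
    divisibility₃ : ∀ x y → x ⊙ (x ⇝ y) ≡ y ⊙ (y ⇝ x)

  _∧_ : Carrier → Carrier → Carrier
  x ∧ y = (x ⇒ y) ⊙ x

  _∨₁_ : Carrier → Carrier → Carrier
  x ∨₁ y = (x ⇒ y) ⇝ y

  _∨₂_ : Carrier → Carrier → Carrier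
  x ∨₂ y = (x ⇝ y) ⇒ y

module _ {a : Level} (A : PseudoHoop a) where
  open PseudoHoop A

  IS1′ : (Carrier → Carrier) → Set a
  IS1′ μ = ∀ x y → (μ (x ⇒ y) ≡ μ (y ∨₁ x) ⇒ μ y) × (μ (x ⇝ y) ≡ μ (y ∨₂ x) ⇝ μ y)

  IS1″ : (Carrier → Carrier) → Set a
  IS1″ μ = ∀ x y → (μ (x ⇒ y) ≡ μ x ⇒ μ (x ∧ y)) × (μ (x ⇝ y) ≡ μ x ⇝ μ (x ∧ y))

  IS2 : (Carrier → Carrier) → Set a
  IS2 μ = ∀ x y → (μ (x ⊙ y) ≡ μ x ⊙ μ (x ⇝ x ⊙ y)) × (μ x ⊙ μ (x ⇝ x ⊙ y) ≡ μ (y ⇒ x ⊙ y) ⊙ μ y)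

  IS3 : (Carrier → Carrier) → Set a
  IS3 μ = ∀ x y → μ (μ x ⊙ μ y) ≡ μ x ⊙ μ y

  IS4 : (Carrier → Carrier) → Set a
  IS4 μ = ∀ x y → (μ (μ x ⇒ μ y) ≡ μ x ⇒ μ y) × (μ (μ x ⇝ μ y) ≡ μ x ⇝ μ y)

  IsTypeIIStateOperator : (Carrier → Carrier) → Set a
  IsTypeIIStateOperator μ = IS1′ μ × IS2 μ × IS3 μ × IS4 μ

  IsTypeIIIStateOperator : (Carrier → Carrier) → Set a
  IsTypeIIIStateOperator μ = IS1″ μ × IS2 μ × IS3 μ × IS4 μ

-- Writing x ≤ y for x ⇒ y ≡ 𝟏, one has x ∧ y ≤ x, so (x ∧ y) ∨₁ x ≡ x and (x ∧ y) ∨₂ x ≡ x,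
-- and moreover x ⇒ (x ∧ y) ≡ x ⇒ y and x ⇝ (x ∧ y) ≡ x ⇝ y. Instantiating (IS1′) at the pair
-- (x, x ∧ y) therefore yields exactly (IS1″) at (x, y); the remaining axioms are shared.
module Submission where

open import Defs
open import Level using (Level)
open import Relation.Binary.PropositionalEquality using (_≡_; sym; trans; cong; cong₂; module ≡-Reasoning)
open import Data.Product using (_,_; proj₁; proj₂)

module PseudoHoopOrder {a : Level} (A : PseudoHoop a) where
  open PseudoHoop A
  open ≡-Reasoning

  infix 4 _≤_

  _≤_ : Carrier → Carrier → Set a
  x ≤ y = x ⇒ y ≡ 𝟏

  ≤-antisym : ∀ {x y} → x ≤ y → y ≤ x → x ≡ y
  ≤-antisym {x} {y} x≤y y≤x = begin
    x               ≡⟨ sym (⊙-identityˡ x) ⟩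
    𝟏 ⊙ x           ≡⟨ cong (_⊙ x) (sym x≤y) ⟩
    (x ⇒ y) ⊙ x     ≡⟨ divisibility₁ x y ⟩
    (y ⇒ x) ⊙ y     ≡⟨ cong (_⊙ y) y≤x ⟩
    𝟏 ⊙ y           ≡⟨ ⊙-identityˡ y ⟩
    y               ∎

  ⊙≤⇒≤⇒ : ∀ {u x z} → u ⊙ x ≤ z → u ≤ x ⇒ z
  ⊙≤⇒≤⇒ {u} {x} {z} ux≤z = trans (sym (⇒-curry u x z)) ux≤z

  ≤⇒⇒⊙≤ : ∀ {u x z} → u ≤ x ⇒ z → u ⊙ x ≤ z
  ≤⇒⇒⊙≤ {u} {x} {z} u≤x⇒z = trans (⇒-curry u x z) u≤x⇒z

  ∧≡⊙⇝ : ∀ x y → x ∧ y ≡ x ⊙ (x ⇝ y)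
  ∧≡⊙⇝ x y = trans (divisibility₁ x y) (divisibility₂ x y)

  ≤⇒∧≡ˡ : ∀ {x y} → x ≤ y → x ∧ y ≡ x
  ≤⇒∧≡ˡ {x} x≤y = trans (cong (_⊙ x) x≤y) (⊙-identityˡ x)

  ≤⇒∧≡ʳ : ∀ {x y} → y ≤ x → x ∧ y ≡ y
  ≤⇒∧≡ʳ {x} {y} y≤x = trans (divisibility₁ x y) (≤⇒∧≡ˡ y≤x)

  ∧≤ʳ : ∀ x y → x ∧ y ≤ y
  ∧≤ʳ x y = ≤⇒⇒⊙≤ (⇒-refl (x ⇒ y))

  [x⇒𝟏]⇒𝟏≤𝟏 : ∀ x → (x ⇒ 𝟏) ⇒ 𝟏 ≤ 𝟏
  [x⇒𝟏]⇒𝟏≤𝟏 x = begin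
    v ⇒ 𝟏             ≡⟨ cong (λ t → (t ⇒ 𝟏) ⇒ 𝟏) u≡v⊙u ⟩
    ((v ⊙ u) ⇒ 𝟏) ⇒ 𝟏 ≡⟨ cong (_⇒ 𝟏) (⇒-curry v u 𝟏) ⟩
    (v ⇒ v) ⇒ 𝟏       ≡⟨ cong (_⇒ 𝟏) (⇒-refl v) ⟩
    𝟏 ⇒ 𝟏             ≡⟨ ⇒-refl 𝟏 ⟩
    𝟏                 ∎
    where
    u = x ⇒ 𝟏
    v = u ⇒ 𝟏
    u≡v⊙u : u ≡ v ⊙ u
    u≡v⊙u = begin
      u             ≡⟨ cong (_⇒ 𝟏) (sym (⊙-identityˡ x)) ⟩
      (𝟏 ⊙ x) ⇒ 𝟏   ≡⟨ ⇒-curry 𝟏 x 𝟏 ⟩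
      𝟏 ⇒ u         ≡⟨ sym (⊙-identityʳ (𝟏 ⇒ u)) ⟩
      (𝟏 ⇒ u) ⊙ 𝟏   ≡⟨ divisibility₁ 𝟏 u ⟩
      v ⊙ u         ∎

  -- With w = 𝟏 ⇒ x one has x ≤ w and w ≡ (x ⇒ 𝟏) ⊙ x, so x ≡ w ∧ x reduces x ⇒ 𝟏 to the previous lemma.
  x≤𝟏 : ∀ x → x ≤ 𝟏
  x≤𝟏 x = begin
    x ⇒ 𝟏                 ≡⟨ cong (_⇒ 𝟏) (sym (≤⇒∧≡ʳ x≤w)) ⟩
    ((w ⇒ x) ⊙ w) ⇒ 𝟏     ≡⟨ ⇒-curry (w ⇒ x) w 𝟏 ⟩
    (w ⇒ x) ⇒ (w ⇒ 𝟏)     ≡⟨ cong₂ _⇒_ (trans (cong (_⇒ x) w≡u⊙x) (⇒-curry u x x))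
                                       (trans (cong (_⇒ 𝟏) w≡u⊙x) (⇒-curry u x 𝟏)) ⟩
    (u ⇒ (x ⇒ x)) ⇒ (u ⇒ u) ≡⟨ cong₂ (λ s t → (u ⇒ s) ⇒ t) (⇒-refl x) (⇒-refl u) ⟩
    (u ⇒ 𝟏) ⇒ 𝟏           ≡⟨ [x⇒𝟏]⇒𝟏≤𝟏 x ⟩
    𝟏                     ∎
    where
    u = x ⇒ 𝟏
    w = 𝟏 ⇒ x
    x≤w : x ≤ w
    x≤w = trans (sym (⇒-curry x 𝟏 x)) (trans (cong (_⇒ x) (⊙-identityʳ x)) (⇒-refl x))
    w≡u⊙x : w ≡ u ⊙ x
    w≡u⊙x = trans (sym (⊙-identityʳ w)) (sym (divisibility₁ x 𝟏))

  ∧≤ˡ : ∀ x y → x ∧ y ≤ x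
  ∧≤ˡ x y = ≤⇒⇒⊙≤ (trans (cong ((x ⇒ y) ⇒_) (⇒-refl x)) (x≤𝟏 (x ⇒ y)))

  𝟏⇒x≡x : ∀ x → 𝟏 ⇒ x ≡ x
  𝟏⇒x≡x x = begin
    𝟏 ⇒ x         ≡⟨ sym (⊙-identityʳ (𝟏 ⇒ x)) ⟩
    (𝟏 ⇒ x) ⊙ 𝟏   ≡⟨ ≤⇒∧≡ʳ (x≤𝟏 x) ⟩
    x             ∎

  𝟏⇝x≡x : ∀ x → 𝟏 ⇝ x ≡ x
  𝟏⇝x≡x x = begin
    𝟏 ⇝ x         ≡⟨ sym (⊙-identityˡ (𝟏 ⇝ x)) ⟩
    𝟏 ⊙ (𝟏 ⇝ x)   ≡⟨ sym (divisibility₃ x 𝟏) ⟩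
    x ⊙ (x ⇝ 𝟏)   ≡⟨ sym (∧≡⊙⇝ x 𝟏) ⟩
    x ∧ 𝟏         ≡⟨ ≤⇒∧≡ˡ (x≤𝟏 x) ⟩
    x             ∎

  ≤⇒⇝≡𝟏 : ∀ {x y} → x ≤ y → x ⇝ y ≡ 𝟏
  ≤⇒⇝≡𝟏 {x} {y} x≤y = begin
    x ⇝ y                 ≡⟨ cong (_⇝ y) (sym x⊙[x⇝y]≡x) ⟩
    (x ⊙ (x ⇝ y)) ⇝ y     ≡⟨ ⇝-curry x (x ⇝ y) y ⟩
    (x ⇝ y) ⇝ (x ⇝ y)     ≡⟨ ⇝-refl (x ⇝ y) ⟩
    𝟏                     ∎
    where
    x⊙[x⇝y]≡x : x ⊙ (x ⇝ y) ≡ x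
    x⊙[x⇝y]≡x = trans (sym (∧≡⊙⇝ x y)) (≤⇒∧≡ˡ x≤y)

  ⇝≡𝟏⇒≤ : ∀ {x y} → x ⇝ y ≡ 𝟏 → x ≤ y
  ⇝≡𝟏⇒≤ {x} {y} x⇝y≡𝟏 = begin
    x ⇒ y                 ≡⟨ cong (_⇒ y) (sym x∧y≡x) ⟩
    ((x ⇒ y) ⊙ x) ⇒ y     ≡⟨ ∧≤ʳ x y ⟩
    𝟏                     ∎
    where
    x∧y≡x : x ∧ y ≡ x
    x∧y≡x = trans (∧≡⊙⇝ x y) (trans (cong (x ⊙_) x⇝y≡𝟏) (⊙-identityʳ x))

  ⊙≤⇒≤⇝ : ∀ {x u z} → x ⊙ u ≤ z → u ≤ x ⇝ z
  ⊙≤⇒≤⇝ {x} {u} {z} xu≤z = ⇝≡𝟏⇒≤ (trans (sym (⇝-curry x u z)) (≤⇒⇝≡𝟏 xu≤z))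

  ≤⇒∨₁≡ʳ : ∀ {x y} → x ≤ y → x ∨₁ y ≡ y
  ≤⇒∨₁≡ʳ {y = y} x≤y = trans (cong (_⇝ y) x≤y) (𝟏⇝x≡x y)

  ≤⇒∨₂≡ʳ : ∀ {x y} → x ≤ y → x ∨₂ y ≡ y
  ≤⇒∨₂≡ʳ {y = y} x≤y = trans (cong (_⇒ y) (≤⇒⇝≡𝟏 x≤y)) (𝟏⇒x≡x y)

  x⇒x∧y≡x⇒y : ∀ x y → x ⇒ (x ∧ y) ≡ x ⇒ y
  x⇒x∧y≡x⇒y x y = ≤-antisym (⊙≤⇒≤⇒ x∧[x∧y]≤y) (⊙≤⇒≤⇒ {x ⇒ y} {x} (⇒-refl (x ∧ y)))
    where
    x∧[x∧y]≤y : x ∧ (x ∧ y) ≤ y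
    x∧[x∧y]≤y = trans (cong (_⇒ y) (≤⇒∧≡ʳ (∧≤ˡ x y))) (∧≤ʳ x y)

  x⇝x∧y≡x⇝y : ∀ x y → x ⇝ (x ∧ y) ≡ x ⇝ y
  x⇝x∧y≡x⇝y x y = ≤-antisym (⊙≤⇒≤⇝ x⊙[x⇝x∧y]≤y) (⊙≤⇒≤⇝ x⊙[x⇝y]≤x∧y)
    where
    x⊙[x⇝x∧y]≤y : x ⊙ (x ⇝ (x ∧ y)) ≤ y
    x⊙[x⇝x∧y]≤y = trans (cong (_⇒ y) (trans (sym (∧≡⊙⇝ x (x ∧ y))) (≤⇒∧≡ʳ (∧≤ˡ x y)))) (∧≤ʳ x y)
    x⊙[x⇝y]≤x∧y : x ⊙ (x ⇝ y) ≤ x ∧ y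
    x⊙[x⇝y]≤x∧y = trans (cong (_⇒ (x ∧ y)) (sym (∧≡⊙⇝ x y))) (⇒-refl (x ∧ y))

module _ {a : Level} (A : PseudoHoop a) where
  open PseudoHoop A
  open PseudoHoopOrder A

  IS1′⇒IS1″ : (μ : Carrier → Carrier) → IS1′ A μ → IS1″ A μ
  IS1′⇒IS1″ μ is1′ x y = μ[x⇒y] , μ[x⇝y]
    where
    open ≡-Reasoning
    x∧y≤x : x ∧ y ≤ x
    x∧y≤x = ∧≤ˡ x y
    μ[x⇒y] : μ (x ⇒ y) ≡ μ x ⇒ μ (x ∧ y)
    μ[x⇒y] = begin
      μ (x ⇒ y)                     ≡⟨ cong μ (sym (x⇒x∧y≡x⇒y x y)) ⟩
      μ (x ⇒ (x ∧ y))               ≡⟨ proj₁ (is1′ x (x ∧ y)) ⟩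
      μ ((x ∧ y) ∨₁ x) ⇒ μ (x ∧ y)  ≡⟨ cong (λ t → μ t ⇒ μ (x ∧ y)) (≤⇒∨₁≡ʳ x∧y≤x) ⟩
      μ x ⇒ μ (x ∧ y)               ∎
    μ[x⇝y] : μ (x ⇝ y) ≡ μ x ⇝ μ (x ∧ y)
    μ[x⇝y] = begin
      μ (x ⇝ y)                     ≡⟨ cong μ (sym (x⇝x∧y≡x⇝y x y)) ⟩
      μ (x ⇝ (x ∧ y))               ≡⟨ proj₂ (is1′ x (x ∧ y)) ⟩
      μ ((x ∧ y) ∨₂ x) ⇝ μ (x ∧ y)  ≡⟨ cong (λ t → μ t ⇝ μ (x ∧ y)) (≤⇒∨₂≡ʳ x∧y≤x) ⟩
      μ x ⇝ μ (x ∧ y)               ∎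

theorem5p12 : ∀ {a : Level} (A : PseudoHoop a) (μ : PseudoHoop.Carrier A → PseudoHoop.Carrier A) →
    IsTypeIIStateOperator A μ → IsTypeIIIStateOperator A μ
theorem5p12 A μ (is1′ , is2 , is3 , is4) = IS1′⇒IS1″ A μ is1′ , is2 , is3 , is4
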